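{- Let $(X,d)$ be a finite metric space with diameter $1$ and at least two points, and let $\mathcal P=(P^0,\ldots,P^M)$ be any $\tau$-stack of $X$. Then for all $x,y\in X$, $$\mathbb d_\tau(F_{\mathcal P}(x),F_{\mathcal P}(y))\le\tau\sum_{j\ge1}\tau^{ -j}\,\mathbf 1_{\{P^j(x)\ne P^j(y)\}}.$$
   Context: Fix $\tau=4$ and let $M\in\mathbb N$ be the smallest integer with $\tau^{ -M}<d(x,y)$ for all $x\neq y$. A chain is a sequence $\xi=(\xi_0,\ldots,\xi_\ell)$ of subsets of $X$, $0\le\ell\le M$, with $\xi_0=X\supseteq\xi_1\supseteq\cdots\supseteq\xi_\ell$; its length is $\ell$. It is complete if $\ell=M$ and $|\xi_M|=1$; $\bar{\mathcal C}_X$ is the set of complete chains. For distinct complete chains, $\mathbb d_\tau(\xi,\xi')=\tau^{ -\mathrm{len}(\mathsf{lca}(\xi,\xi'))}$ where $\mathsf{lca}(\xi,\xi')$ is their longest common prefix, and $\mathbb d_\tau(\xi,\xi)=0$. A $\tau$-stack is a sequence $\mathcal P=(P^0,\ldots,P^M)$ of partitions of $X$ with $P^0=\{X\}$ and $\mathrm{diam}(S)\le\tau^{ -j}$ for every $S\in P^j$, $j\ge1$; $P(x)$ is the part of $P$ containing $x$. The forced refinement is $\hat P^0=P^0$, $\hat P^j=\{S\cap S':S\in P^j,S'\in\hat P^{j-1}\}$, and $F_{\mathcal P}(x)=(\hat P^0(x),\ldots,\hat P^M(x))$.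
   Formalization: The metric d takes values in the rationals. -}

module Defs where

open import Data.Nat as ℕ using (ℕ; zero; suc; _∸_)
open import Data.Fin using (Fin)
open import Data.Fin.Subset using (Subset; _∩_; ⊤)
open import Data.Vec using (Vec; []; _∷_; tabulate)
import Data.Vec.Properties as VecP
open import Data.Bool using (Bool; true; false)
import Data.Bool.Properties as BoolP
open import Data.Integer using (+_)
open import Data.Rational using (ℚ; 0ℚ; 1ℚ; _/_; _*_; _+_; _≤_; _<_)
open import Relation.Binary.PropositionalEquality using (_≡_; _≢_)
open import Relation.Nullary using (yes; no; ¬_; Dec)
open import Relation.Nullary.Decidable using (⌊_⌋)
open import Data.Product using (Σ; _×_; ∃)
open import Data.Sum using (_⊎_)

τ : ℚ
τ = + 4 / 1

τ^- : ℕ → ℚ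
τ^- zero = 1ℚ
τ^- (suc j) = (+ 1 / 4) * τ^- j

record IsMetric {n : ℕ} (d : Fin n → Fin n → ℚ) : Set where
  field
    nonneg   : ∀ x y → 0ℚ ≤ d x y
    zero⇔eq  : ∀ x y → (d x y ≡ 0ℚ → x ≡ y) × (x ≡ y → d x y ≡ 0ℚ)
    symm     : ∀ x y → d x y ≡ d y x
    triangle : ∀ x y z → d x z ≤ d x y + d y z

HasDiameterOne : {n : ℕ} → (Fin n → Fin n → ℚ) → Set
HasDiameterOne {n} d = (∀ x y → d x y ≤ 1ℚ) × Σ (Fin n) λ x → Σ (Fin n) λ y → d x y ≡ 1ℚ

Separates : {n : ℕ} → (Fin n → Fin n → ℚ) → ℕ → Set
Separates {n} d m = ∀ (x y : Fin n) → x ≢ y → τ^- m < d x y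

IsM : {n : ℕ} → (Fin n → Fin n → ℚ) → ℕ → Set
IsM d M = Separates d M × (∀ m → m ℕ.< M → ¬ Separates d m)

-- A partition of Fin n, encoded by a block-labelling: x and y lie in the
-- same part iff they have the same label. The part containing x:
Partition : ℕ → Set
Partition n = Fin n → ℕ

part : {n : ℕ} → Partition n → Fin n → Subset n
part {n} P x = tabulate λ z → ⌊ P z ℕ.≟ P x ⌋

-- τ-stack (P^0, …, P^M): P^0 = {X}, diam S ≤ τ^{-j} for S ∈ P^j, 1 ≤ j ≤ M.
-- (Only the indices 0..M of the sequence P are ever used.)
IsTauStack : {n : ℕ} → (Fin n → Fin n → ℚ) → ℕ → (ℕ → Partition n) → Set
IsTauStack {n} d M P =
  (∀ x y → P 0 x ≡ P 0 y) ×
  (∀ j → 1 ℕ.≤ j → j ℕ.≤ M → ∀ x y → part (P j) x ≡ part (P j) y → d x y ≤ τ^- j)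

hatPart : {n : ℕ} → (ℕ → Partition n) → ℕ → Fin n → Subset n
hatPart P zero x = part (P 0) x
hatPart P (suc j) x = part (P (suc j)) x ∩ hatPart P j x

F : {n : ℕ} → (ℕ → Partition n) → (M : ℕ) → Fin n → Vec (Subset n) (suc M)
F P M x = tabulate λ i → hatPart P (Data.Fin.toℕ i) x

commonEntries : {n k : ℕ} → Vec (Subset n) k → Vec (Subset n) k → ℕ
commonEntries [] [] = 0
commonEntries (a ∷ as) (b ∷ bs) with VecP.≡-dec BoolP._≟_ a b
... | yes _ = suc (commonEntries as bs)
... | no _ = 0

-- the length ℓ of the chain lca(ξ,ξ') = (ξ_0,…,ξ_ℓ) is (#entries − 1)
lcaLen : {n k : ℕ} → Vec (Subset n) k → Vec (Subset n) k → ℕ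
lcaLen ξ ξ' = commonEntries ξ ξ' ∸ 1

dτ : {n k : ℕ} → Vec (Subset n) k → Vec (Subset n) k → ℚ
dτ ξ ξ' with VecP.≡-dec (VecP.≡-dec BoolP._≟_) ξ ξ'
... | yes _ = 0ℚ
... | no _ = τ^- (lcaLen ξ ξ')

indNe : {n : ℕ} → Partition n → Fin n → Fin n → ℚ
indNe P x y with VecP.≡-dec BoolP._≟_ (part P x) (part P y)
... | yes _ = 0ℚ
... | no _ = 1ℚ

weightedSum : {n : ℕ} → (ℕ → Partition n) → ℕ → Fin n → Fin n → ℚ
weightedSum P zero x y = 0ℚ
weightedSum P (suc j) x y = weightedSum P j x y + τ^- (suc j) * indNe (P (suc j)) x y

-- Let c be the first level at which the forced refinements of x and y differ.
-- As P⁰ = {X}, c ≥ 1 and lca(F x, F y) has length c − 1. Since the parts of x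
-- and y agree in P̂^(c−1) but not in P̂^c = P^c ∩ P̂^(c−1), they differ already
-- in P^c, so the c-th summand τ^-c of the weighted sum is present and
-- d_τ(F x, F y) = τ^-(c−1) = τ · τ^-c.
module Submission where

open import Defs
open import Data.Nat using (ℕ; zero; suc; _≤_; _<_; _∸_; z≤n; s≤s; _≤′_; ≤′-refl; ≤′-step; _≟_)
open import Data.Nat.Properties using (≤⇒≤′; ≤-refl)
open import Data.Fin using (Fin; toℕ)
open import Data.Fin.Subset using (Subset; _∩_)
open import Data.Vec using (Vec; tabulate; _∷_)
import Data.Vec.Properties as Vec
import Data.Bool.Properties as Bool
open import Data.Rational using (ℚ; 0ℚ; 1ℚ; _/_; _*_; _+_; NonNegative) renaming (_≤_ to _≤ℚ_)
open import Data.Rational.Properties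
  using (≤-trans; ≤-reflexive; +-identityʳ; +-identityˡ; *-identityʳ; *-identityˡ; *-assoc;
         +-monoʳ-≤; +-monoˡ-≤; *-monoˡ-≤-nonNeg; nonNegative⁻¹;
         nonNeg+nonNeg⇒nonNeg; nonNeg*nonNeg⇒nonNeg; module ≤-Reasoning)
  renaming (≤-refl to ≤ℚ-refl)
open import Data.Integer using (+_)
open import Data.Product using (Σ; _×_; _,_)
open import Data.Empty using (⊥-elim)
open import Function using (_∘_)
open import Relation.Binary.PropositionalEquality using (_≡_; _≢_; refl; sym; cong; cong₂; module ≡-Reasoning)
open import Relation.Nullary using (yes; no)
open import Relation.Nullary.Decidable using (⌊_⌋)

τ^--nonNeg : ∀ j → NonNegative (τ^- j)
τ^--nonNeg zero = _
τ^--nonNeg (suc j) = nonNeg*nonNeg⇒nonNeg (+ 1 / 4) (τ^- j) {{τ^--nonNeg j}}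

τ*τ^-suc : ∀ j → τ * τ^- (suc j) ≡ τ^- j
τ*τ^-suc j = begin
  τ * (+ 1 / 4 * τ^- j) ≡⟨ sym (*-assoc τ (+ 1 / 4) (τ^- j)) ⟩
  1ℚ * τ^- j            ≡⟨ *-identityˡ (τ^- j) ⟩
  τ^- j                 ∎
  where open ≡-Reasoning

p≤p+q : ∀ p {q} → 0ℚ ≤ℚ q → p ≤ℚ p + q
p≤p+q p q≥0 = ≤-trans (≤-reflexive (sym (+-identityʳ p))) (+-monoʳ-≤ p q≥0)

dτ-≤ : ∀ {n k} (ξ ξ' : Vec (Subset n) k) {q : ℚ} → 0ℚ ≤ℚ q →
       (ξ ≢ ξ' → τ^- (lcaLen ξ ξ') ≤ℚ q) → dτ ξ ξ' ≤ℚ q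
dτ-≤ ξ ξ' q≥0 lca≤q with Vec.≡-dec (Vec.≡-dec Bool._≟_) ξ ξ'
... | yes _     = q≥0
... | no  ξ≢ξ' = lca≤q ξ≢ξ'

firstDifference : ∀ {n} k (h h' : ℕ → Subset n) →
  tabulate {n = k} (h ∘ toℕ) ≢ tabulate (h' ∘ toℕ) →
  Σ ℕ λ c → commonEntries (tabulate {n = k} (h ∘ toℕ)) (tabulate (h' ∘ toℕ)) ≡ c
          × c < k × h c ≢ h' c × (∀ i → i < c → h i ≡ h' i)
firstDifference zero h h' tab≢ = ⊥-elim (tab≢ refl)
firstDifference (suc k) h h' tab≢ with Vec.≡-dec Bool._≟_ (h 0) (h' 0)
... | no  h₀≢h'₀ = 0 , refl , s≤s z≤n , h₀≢h'₀ , λ _ ()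
... | yes h₀≡h'₀
  with firstDifference k (h ∘ suc) (h' ∘ suc) (tab≢ ∘ cong₂ _∷_ h₀≡h'₀)
...  | c , common≡c , c<k , differ , agree =
       suc c , cong suc common≡c , s≤s c<k , differ , agree′
  where
  agree′ : ∀ i → i < suc c → h i ≡ h' i
  agree′ zero    _         = h₀≡h'₀
  agree′ (suc i) (s≤s i<c) = agree i i<c

part-cong : ∀ {n} (Q : Partition n) {x y} → Q x ≡ Q y → part Q x ≡ part Q y
part-cong Q Qx≡Qy = cong (λ label → tabulate λ z → ⌊ Q z ≟ label ⌋) Qx≡Qy

indNe-nonNeg : ∀ {n} (Q : Partition n) x y → NonNegative (indNe Q x y)
indNe-nonNeg Q x y with Vec.≡-dec Bool._≟_ (part Q x) (part Q y)
... | yes _ = _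
... | no  _ = _

indNe-≢ : ∀ {n} (Q : Partition n) {x y} → part Q x ≢ part Q y → indNe Q x y ≡ 1ℚ
indNe-≢ Q {x} {y} Qx≢Qy with Vec.≡-dec Bool._≟_ (part Q x) (part Q y)
... | yes Qx≡Qy = ⊥-elim (Qx≢Qy Qx≡Qy)
... | no  _     = refl

module _ {n : ℕ} (P : ℕ → Partition n) (x y : Fin n) where

  summand : ℕ → ℚ
  summand j = τ^- j * indNe (P j) x y

  summand-nonNeg : ∀ j → NonNegative (summand j)
  summand-nonNeg j = nonNeg*nonNeg⇒nonNeg (τ^- j) {{τ^--nonNeg j}}
                                          (indNe (P j) x y) {{indNe-nonNeg (P j) x y}}

  weightedSum-nonNeg : ∀ m → NonNegative (weightedSum P m x y)
  weightedSum-nonNeg zero    = _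
  weightedSum-nonNeg (suc m) =
    nonNeg+nonNeg⇒nonNeg (weightedSum P m x y) {{weightedSum-nonNeg m}}
                         (summand (suc m)) {{summand-nonNeg (suc m)}}

  weightedSum-mono : ∀ {j m} → j ≤′ m → weightedSum P j x y ≤ℚ weightedSum P m x y
  weightedSum-mono ≤′-refl            = ≤ℚ-refl
  weightedSum-mono (≤′-step {m} j≤′m) = ≤-trans (weightedSum-mono j≤′m)
    (p≤p+q (weightedSum P m x y) (nonNegative⁻¹ (summand (suc m)) {{summand-nonNeg (suc m)}}))

  τ^-≤weightedSum : ∀ {j m} → suc j ≤ m → part (P (suc j)) x ≢ part (P (suc j)) y →
                    τ^- (suc j) ≤ℚ weightedSum P m x y
  τ^-≤weightedSum {j} {m} j<m parts≢ = begin
    τ^- (suc j)                           ≡⟨ sym (*-identityʳ (τ^- (suc j))) ⟩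
    τ^- (suc j) * 1ℚ                      ≡⟨ cong (τ^- (suc j) *_) (sym (indNe-≢ (P (suc j)) parts≢)) ⟩
    summand (suc j)                       ≡⟨ sym (+-identityˡ (summand (suc j))) ⟩
    0ℚ + summand (suc j)                  ≤⟨ +-monoˡ-≤ (summand (suc j)) 0≤weightedSum ⟩
    weightedSum P j x y + summand (suc j) ≤⟨ weightedSum-mono (≤⇒≤′ j<m) ⟩
    weightedSum P m x y                   ∎
    where
    open ≤-Reasoning
    0≤weightedSum : 0ℚ ≤ℚ weightedSum P j x y
    0≤weightedSum = nonNegative⁻¹ (weightedSum P j x y) {{weightedSum-nonNeg j}}

  hatPart-split : ∀ c → hatPart P c x ≡ hatPart P c y →
                  hatPart P (suc c) x ≢ hatPart P (suc c) y →
                  part (P (suc c)) x ≢ part (P (suc c)) y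
  hatPart-split c agree differ Pᶜx≡Pᶜy = differ (cong₂ _∩_ Pᶜx≡Pᶜy agree)

  τ^-lcaLen≤ : (∀ u v → P 0 u ≡ P 0 v) → ∀ M → F P M x ≢ F P M y →
               τ^- (lcaLen (F P M x) (F P M y)) ≤ℚ τ * weightedSum P M x y
  τ^-lcaLen≤ P⁰-trivial M Fx≢Fy
    with firstDifference (suc M) (λ j → hatPart P j x) (λ j → hatPart P j y) Fx≢Fy
  ... | zero  , _ , _ , differ , _ = ⊥-elim (differ (part-cong (P 0) (P⁰-trivial x y)))
  ... | suc c , common≡ , s≤s c<M , differ , agree = begin
    τ^- (lcaLen (F P M x) (F P M y)) ≡⟨ cong (λ k → τ^- (k ∸ 1)) common≡ ⟩
    τ^- c                            ≡⟨ sym (τ*τ^-suc c) ⟩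
    τ * τ^- (suc c)                  ≤⟨ *-monoˡ-≤-nonNeg τ (τ^-≤weightedSum c<M split) ⟩
    τ * weightedSum P M x y          ∎
    where
    open ≤-Reasoning
    split : part (P (suc c)) x ≢ part (P (suc c)) y
    split = hatPart-split c (agree c ≤-refl) differ

lemma4p3 : (n : ℕ) → 2 ≤ n → (d : Fin n → Fin n → ℚ) → IsMetric d → HasDiameterOne d
    → (M : ℕ) → IsM d M → (P : ℕ → Partition n) → IsTauStack d M P
    → ∀ (x y : Fin n) → dτ (F P M x) (F P M y) ≤ℚ τ * weightedSum P M x y
lemma4p3 _ _ _ _ _ M _ P (P⁰-trivial , _) x y =
  dτ-≤ (F P M x) (F P M y) 0≤τ*weightedSum (τ^-lcaLen≤ P x y P⁰-trivial M)
  where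
  0≤τ*weightedSum : 0ℚ ≤ℚ τ * weightedSum P M x y
  0≤τ*weightedSum = nonNegative⁻¹ _
    {{nonNeg*nonNeg⇒nonNeg τ (weightedSum P M x y) {{weightedSum-nonNeg P x y M}}}}
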